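{- Let $\ell$ be a prime, $q$ a prime power, $0\le B\le C$ integers, $D\in(\mathbb{Z}/\ell^C\mathbb{Z})^\times$ with $D^2q\equiv1\pmod{\ell^B}$. Then for every integer $i$ with $C\le i\le C+B$, the residue class $\tilde Dq+\tilde D^{ -1}\pmod{\ell^i}$ is the same for every lift $\tilde D\in\mathbb{Z}/\ell^i\mathbb{Z}$ of $D$ (i.e. every $\tilde D$ reducing to $D$ modulo $\ell^C$).
   Context: Here $\tilde D^{ -1}$ denotes the inverse of $\tilde D$ in $(\mathbb{Z}/\ell^i\mathbb{Z})^\times$ (every lift of a unit is a unit). -}

module Defs where

open import Data.Nat using (ℕ; _^_; _≥_)
open import Data.Nat.Primality using (Prime)
open import Data.Product using (Σ; ∃; _×_)
open import Data.Integer using (ℤ)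
open import Data.Integer.Divisibility using (_∣_)
open import Data.Integer using (_-_)
open import Relation.Binary.PropositionalEquality using (_≡_)

IsPrimePower : ℕ → Set
IsPrimePower q = Σ ℕ λ p → Σ ℕ λ k → Prime p × k ≥ 1 × q ≡ p ^ k

module Submission where

-- The argument is a ring identity.  For lifts d₁, d₂ of d with inverses e₁, e₂,
--   (d₁ q + e₁) - (d₂ q + e₂)
--     = e₁ e₂ (d₁ - d₂)(d₁ d₂ q - 1)                (divisible by ℓ^C · ℓ^B)
--       - (d₁ - d₂) q (d₁ e₁ · d₂ e₂ - 1)            (d₁e₁ d₂e₂ is a unit ≡ 1)
--       + ((e₁ - e₂) + e₁ e₂ (d₁ - d₂))              (difference of inverses)
-- and each summand is divisible by ℓ^i.

open import Defs
open import Data.Nat using (ℕ; _≤_; _^_)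
open import Data.Nat as N using ()
open import Data.Nat.Primality using (Prime)
open import Data.Integer using (ℤ; +_; _*_; _-_; _+_; 1ℤ)
open import Data.Integer.Divisibility using (_∣_)
open import Relation.Nullary using (¬_)
open import Data.Product using (_,_)
import Data.Nat.Properties as NP
import Data.Nat.Divisibility as ND
import Data.Integer.Properties as ZP
open import Data.Integer.Divisibility.Signed as S
  using (∣-trans; ∣m∣n⇒∣m+n; ∣m∣n⇒∣m-n; ∣n⇒∣m*n; ∣m⇒∣m*n; *-monoˡ-∣; *-monoʳ-∣)
  renaming (_∣_ to _∣ₛ_)
open import Data.Integer.Tactic.RingSolver using (solve-∀)
open import Relation.Binary.PropositionalEquality using (_≡_; sym; trans; cong; subst)

*-pres-∣ : ∀ {a b x y : ℤ} → a ∣ₛ x → b ∣ₛ y → a * b ∣ₛ x * y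
*-pres-∣ {b = b} {x = x} a∣x b∣y = ∣-trans (*-monoˡ-∣ b a∣x) (*-monoʳ-∣ x b∣y)

lifts-congruent : ∀ {m} d d₁ d₂ → m ∣ₛ d₁ - d → m ∣ₛ d₂ - d → m ∣ₛ d₁ - d₂
lifts-congruent {m} d d₁ d₂ h₁ h₂ = subst (m ∣ₛ_) (identity d d₁ d₂) (∣m∣n⇒∣m-n h₁ h₂)
  where
  identity : ∀ d d₁ d₂ → (d₁ - d) - (d₂ - d) ≡ d₁ - d₂
  identity = solve-∀

one-*-one : ∀ {m} u v → m ∣ₛ u - 1ℤ → m ∣ₛ v - 1ℤ → m ∣ₛ u * v - 1ℤ
one-*-one {m} u v hu hv =
  subst (m ∣ₛ_) (identity u v) (∣m∣n⇒∣m+n (∣m⇒∣m*n v hu) hv)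
  where
  identity : ∀ u v → (u - 1ℤ) * v + (v - 1ℤ) ≡ u * v - 1ℤ
  identity = solve-∀

inverse-difference : ∀ {m} d₁ d₂ e₁ e₂ → m ∣ₛ d₁ * e₁ - 1ℤ → m ∣ₛ d₂ * e₂ - 1ℤ →
                     m ∣ₛ (e₁ - e₂) + e₁ * e₂ * (d₁ - d₂)
inverse-difference {m} d₁ d₂ e₁ e₂ u₁ u₂ =
  subst (m ∣ₛ_) (identity d₁ d₂ e₁ e₂) (∣m∣n⇒∣m-n (∣n⇒∣m*n e₂ u₁) (∣n⇒∣m*n e₁ u₂))
  where
  identity : ∀ d₁ d₂ e₁ e₂ →
             e₂ * (d₁ * e₁ - 1ℤ) - e₁ * (d₂ * e₂ - 1ℤ) ≡ (e₁ - e₂) + e₁ * e₂ * (d₁ - d₂)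
  identity = solve-∀

lifts-norm : ∀ {m n} d q d₁ d₂ → n ∣ₛ m → m ∣ₛ d₁ - d → m ∣ₛ d₂ - d →
             n ∣ₛ d * d * q - 1ℤ → n ∣ₛ d₁ * d₂ * q - 1ℤ
lifts-norm {m} {n} d q d₁ d₂ n∣m h₁ h₂ norm =
  subst (n ∣ₛ_) (identity d q d₁ d₂) (∣m∣n⇒∣m+n norm (∣n⇒∣m*n q (∣-trans n∣m lifts)))
  where
  lifts : m ∣ₛ (d₁ - d) * d₂ + d * (d₂ - d)
  lifts = ∣m∣n⇒∣m+n (∣m⇒∣m*n d₂ h₁) (∣n⇒∣m*n d h₂)
  identity : ∀ d q d₁ d₂ →
             (d * d * q - 1ℤ) + q * ((d₁ - d) * d₂ + d * (d₂ - d)) ≡ d₁ * d₂ * q - 1ℤ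
  identity = solve-∀

trace-difference : ∀ q d₁ d₂ e₁ e₂ →
  (d₁ * q + e₁) - (d₂ * q + e₂) ≡
    e₁ * e₂ * ((d₁ - d₂) * (d₁ * d₂ * q - 1ℤ))
    - (d₁ - d₂) * q * ((d₁ * e₁) * (d₂ * e₂) - 1ℤ)
    + ((e₁ - e₂) + e₁ * e₂ * (d₁ - d₂))
trace-difference = solve-∀

trace-independent-of-lift : ∀ {P m n} d q d₁ d₂ e₁ e₂ → P ∣ₛ m * n → n ∣ₛ m →
  n ∣ₛ d * d * q - 1ℤ → m ∣ₛ d₁ - d → m ∣ₛ d₂ - d →
  P ∣ₛ d₁ * e₁ - 1ℤ → P ∣ₛ d₂ * e₂ - 1ℤ →
  P ∣ₛ (d₁ * q + e₁) - (d₂ * q + e₂)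
trace-independent-of-lift {P} d q d₁ d₂ e₁ e₂ P∣mn n∣m norm h₁ h₂ u₁ u₂ =
  subst (P ∣ₛ_) (sym (trace-difference q d₁ d₂ e₁ e₂))
    (∣m∣n⇒∣m+n (∣m∣n⇒∣m-n norm-term unit-term) (inverse-difference d₁ d₂ e₁ e₂ u₁ u₂))
  where
  norm-term : P ∣ₛ e₁ * e₂ * ((d₁ - d₂) * (d₁ * d₂ * q - 1ℤ))
  norm-term = ∣n⇒∣m*n (e₁ * e₂) (∣-trans P∣mn
    (*-pres-∣ (lifts-congruent d d₁ d₂ h₁ h₂) (lifts-norm d q d₁ d₂ n∣m h₁ h₂ norm)))
  unit-term : P ∣ₛ (d₁ - d₂) * q * ((d₁ * e₁) * (d₂ * e₂) - 1ℤ)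
  unit-term = ∣n⇒∣m*n ((d₁ - d₂) * q) (one-*-one (d₁ * e₁) (d₂ * e₂) u₁ u₂)

pow-∣-pow : ∀ ℓ {a b} → a ≤ b → (+ (ℓ ^ a)) ∣ₛ (+ (ℓ ^ b))
pow-∣-pow ℓ {a} {b} a≤b with NP.m≤n⇒∃[o]m+o≡n a≤b
... | k , a+k≡b = S.∣ᵤ⇒∣ (subst (ℓ ^ a ND.∣_) ℓ^a*ℓ^k≡ℓ^b (ND.m∣m*n (ℓ ^ k)))
  where
  ℓ^a*ℓ^k≡ℓ^b : ℓ ^ a N.* ℓ ^ k ≡ ℓ ^ b
  ℓ^a*ℓ^k≡ℓ^b = trans (sym (NP.^-distribˡ-+-* ℓ a k)) (cong (ℓ ^_) a+k≡b)

pow-+ : ∀ ℓ a b → + (ℓ ^ (a N.+ b)) ≡ + (ℓ ^ a) * + (ℓ ^ b)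
pow-+ ℓ a b = trans (cong +_ (NP.^-distribˡ-+-* ℓ a b)) (ZP.pos-* (ℓ ^ a) (ℓ ^ b))

lemma5 : (ℓ q B C : ℕ) → Prime ℓ → IsPrimePower q → B ≤ C →
         (d : ℤ) → ¬ ((+ ℓ) ∣ d) → (+ (ℓ ^ B)) ∣ ((d * d * (+ q)) - 1ℤ) →
         (i : ℕ) → C ≤ i → i ≤ C N.+ B →
         (d₁ d₂ e₁ e₂ : ℤ) →
         (+ (ℓ ^ C)) ∣ (d₁ - d) → (+ (ℓ ^ C)) ∣ (d₂ - d) →
         (+ (ℓ ^ i)) ∣ ((d₁ * e₁) - 1ℤ) → (+ (ℓ ^ i)) ∣ ((d₂ * e₂) - 1ℤ) →
         (+ (ℓ ^ i)) ∣ ((d₁ * (+ q) + e₁) - (d₂ * (+ q) + e₂))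
lemma5 ℓ q B C _ _ B≤C d _ norm i _ i≤C+B d₁ d₂ e₁ e₂ h₁ h₂ u₁ u₂ =
  S.∣⇒∣ᵤ (trace-independent-of-lift d (+ q) d₁ d₂ e₁ e₂ ℓ^i∣ℓ^C*ℓ^B (pow-∣-pow ℓ B≤C)
           (S.∣ᵤ⇒∣ norm) (S.∣ᵤ⇒∣ h₁) (S.∣ᵤ⇒∣ h₂) (S.∣ᵤ⇒∣ u₁) (S.∣ᵤ⇒∣ u₂))
  where
  ℓ^i∣ℓ^C*ℓ^B : + (ℓ ^ i) ∣ₛ + (ℓ ^ C) * + (ℓ ^ B)
  ℓ^i∣ℓ^C*ℓ^B = subst (+ (ℓ ^ i) ∣ₛ_) (pow-+ ℓ C B) (pow-∣-pow ℓ i≤C+B)
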